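{- For every $n\ge1$, let $L$ be either the normal modal logic $\mathrm{K4}^n\mathrm{B}^n$ or $\mathrm{K4}^n\mathrm{B()}^n$, and let $\langle B_\omega,f\rangle$ be the Lindenbaum–Tarski algebra of $L$ (over countably many propositional variables), with $f$ the interpretation of $\Diamond$. Then $f$ does not have a proper companion.
   Context: $\mathrm{K4}^n\mathrm{B}^n$ is the normal modal logic extending $\mathbf K$ by the axioms $\Diamond^{n+1}A\to\Diamond^nA$ and $\Diamond^n\Box^nA\to A$; $\mathrm{K4}^n\mathrm{B()}^n$ extends $\mathbf K$ by $\Diamond^{n+1}A\to\Diamond^nA$ and $(\Diamond\Box)^nA\to A$. The Lindenbaum–Tarski algebra is the quotient of the formula algebra by provable equivalence, a Boolean algebra $B_\omega$ with the modal operator $f$ induced by $\Diamond$ ($f(0)=0$, $f(x+y)=f(x)+f(y)$). A companion of $f$ is a modal operator $g$ on $B_\omega$ with $f(x)+g(x)=1$ for all $x\neq0$; it is proper if $g$ is not the unary discriminator (the map sending $0$ to $0$ and every nonzero element to $1$). -}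

module Defs where

open import Data.Nat using (ℕ; zero; suc)
open import Data.Product using (_×_; Σ)
open import Relation.Nullary using (¬_)

infixr 5 _⇒_
data Form : Set where
  var : ℕ → Form
  ⊥f  : Form
  _⇒_ : Form → Form → Form
  □_  : Form → Form

¬f_ : Form → Form
¬f A = A ⇒ ⊥f

⊤f : Form
⊤f = ¬f ⊥f

_∨f_ : Form → Form → Form
A ∨f B = (¬f A) ⇒ B

_∧f_ : Form → Form → Form
A ∧f B = ¬f (A ⇒ ¬f B)

◇_ : Form → Form
◇ A = ¬f (□ (¬f A))

iter : ℕ → (Form → Form) → Form → Form
iter zero    h A = A
iter (suc n) h A = h (iter n h A)

data Variant : Set where
  K4B  : Variant   -- K4ⁿBⁿ  : extra axiom ◇ⁿ□ⁿA → A
  K4B' : Variant   -- K4ⁿB()ⁿ: extra axiom (◇□)ⁿA → A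

symAxiom : Variant → ℕ → Form → Form
symAxiom K4B  n A = iter n ◇_ (iter n □_ A) ⇒ A
symAxiom K4B' n A = iter n (λ B → ◇ (□ B)) A ⇒ A

data ⊢[_,_]_ (v : Variant) (n : ℕ) : Form → Set where
  ax1  : ∀ A B → ⊢[ v , n ] (A ⇒ (B ⇒ A))
  ax2  : ∀ A B C → ⊢[ v , n ] ((A ⇒ (B ⇒ C)) ⇒ ((A ⇒ B) ⇒ (A ⇒ C)))
  ax3  : ∀ A B → ⊢[ v , n ] ((¬f A ⇒ ¬f B) ⇒ (B ⇒ A))
  axK  : ∀ A B → ⊢[ v , n ] (□ (A ⇒ B) ⇒ (□ A ⇒ □ B))
  ax4n : ∀ A → ⊢[ v , n ] (iter (suc n) ◇_ A ⇒ iter n ◇_ A)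
  axBn : ∀ A → ⊢[ v , n ] symAxiom v n A
  mp   : ∀ {A B} → ⊢[ v , n ] (A ⇒ B) → ⊢[ v , n ] A → ⊢[ v , n ] B
  nec  : ∀ {A} → ⊢[ v , n ] A → ⊢[ v , n ] (□ A)

-- Equality in the Lindenbaum–Tarski algebra B_ω (provable equivalence)
_≈[_,_]_ : Form → Variant → ℕ → Form → Set
A ≈[ v , n ] B = ⊢[ v , n ] (A ⇒ B) × ⊢[ v , n ] (B ⇒ A)

record IsModalOp (v : Variant) (n : ℕ) (g : Form → Form) : Set where
  field
    cong-g : ∀ A B → A ≈[ v , n ] B → g A ≈[ v , n ] g B
    g-0    : g ⊥f ≈[ v , n ] ⊥f
    g-+    : ∀ A B → g (A ∨f B) ≈[ v , n ] ((g A) ∨f (g B))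

IsCompanion : Variant → ℕ → (Form → Form) → Set
IsCompanion v n g = ∀ A → ¬ (A ≈[ v , n ] ⊥f) → ((◇ A) ∨f (g A)) ≈[ v , n ] ⊤f

IsDiscriminator : Variant → ℕ → (Form → Form) → Set
IsDiscriminator v n g =
  ∀ A → (A ≈[ v , n ] ⊥f → g A ≈[ v , n ] ⊥f)
      × (¬ (A ≈[ v , n ] ⊥f) → g A ≈[ v , n ] ⊤f)

HasProperCompanion : Variant → ℕ → Set
HasProperCompanion v n =
  Σ (Form → Form) λ g → IsModalOp v n g × IsCompanion v n g × ¬ IsDiscriminator v n g

-- Let g be a
-- companion and A ≠ 0.  For a variable p occurring neither in A nor in g(A),
-- A ∧ p ≠ 0 (substitute ⊤ for p), so ¬◇(A ∧ p) ≤ g(A ∧ p) ≤ g(A).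
-- Substituting ⊥ for p gives ¬◇⊥ ≤ g(A), and ¬◇⊥ = 1 in any normal logic;
-- hence g(A) = 1, i.e. g is the discriminator.
module Submission where

open import Defs
open import Data.Nat using (ℕ; zero; suc; _≥_; _≤_; _⊔_; _≟_)
open import Data.Nat.Properties using (<-irrefl; m⊔n≤o⇒m≤o; m⊔n≤o⇒n≤o; m≤m⊔n; m≤n⊔m)
open import Data.List using (List; []; _∷_)
open import Data.List.Membership.Propositional using (_∈_)
open import Data.List.Relation.Unary.Any using (here; there)
open import Data.Product using (_,_; proj₁; proj₂)
open import Data.Empty using (⊥-elim)
open import Relation.Nullary using (¬_; yes; no)
open import Relation.Binary.PropositionalEquality
  using (_≡_; refl; sym; trans; cong; cong₂; subst)

infix 8 _[_≔_]

_[_≔_] : Form → ℕ → Form → Form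
var i   [ k ≔ C ] with i ≟ k
... | yes _ = C
... | no  _ = var i
⊥f      [ k ≔ C ] = ⊥f
(A ⇒ B) [ k ≔ C ] = A [ k ≔ C ] ⇒ B [ k ≔ C ]
(□ A)   [ k ≔ C ] = □ (A [ k ≔ C ])

var-≔ : ∀ k C → (var k [ k ≔ C ]) ≡ C
var-≔ k C with k ≟ k
... | yes _  = refl
... | no k≢k = ⊥-elim (k≢k refl)

varBound : Form → ℕ
varBound (var i) = suc i
varBound ⊥f      = zero
varBound (A ⇒ B) = varBound A ⊔ varBound B
varBound (□ A)   = varBound A

fresh-≔ : ∀ {k} C F → varBound F ≤ k → (F [ k ≔ C ]) ≡ F
fresh-≔ {k} C (var i) bound with i ≟ k
... | yes refl = ⊥-elim (<-irrefl refl bound)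
... | no  _    = refl
fresh-≔ C ⊥f      bound = refl
fresh-≔ C (A ⇒ B) bound = cong₂ _⇒_
  (fresh-≔ C A (m⊔n≤o⇒m≤o (varBound A) (varBound B) bound))
  (fresh-≔ C B (m⊔n≤o⇒n≤o (varBound A) (varBound B) bound))
fresh-≔ C (□ A)   bound = cong □_ (fresh-≔ C A bound)

iter-≔ : ∀ {k C} (h : Form → Form) → (∀ B → (h B [ k ≔ C ]) ≡ h (B [ k ≔ C ])) →
         ∀ m A → (iter m h A [ k ≔ C ]) ≡ iter m h (A [ k ≔ C ])
iter-≔ h h-≔ zero    A = refl
iter-≔ h h-≔ (suc m) A = trans (h-≔ (iter m h A)) (cong h (iter-≔ h h-≔ m A))

iter◇-≔ : ∀ {k C} m A → (iter m ◇_ A [ k ≔ C ]) ≡ iter m ◇_ (A [ k ≔ C ])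
iter◇-≔ = iter-≔ ◇_ (λ _ → refl)

symAxiom-≔ : ∀ {k C} v m A → (symAxiom v m A [ k ≔ C ]) ≡ symAxiom v m (A [ k ≔ C ])
symAxiom-≔ K4B m A = cong₂ _⇒_
  (trans (iter◇-≔ m (iter m □_ A)) (cong (iter m ◇_) (iter-≔ □_ (λ _ → refl) m A)))
  refl
symAxiom-≔ K4B' m A = cong₂ _⇒_ (iter-≔ (λ B → ◇ (□ B)) (λ _ → refl) m A) refl

⊢-≔ : ∀ {v n A} k C → ⊢[ v , n ] A → ⊢[ v , n ] (A [ k ≔ C ])
⊢-≔ k C (ax1 A B)   = ax1 _ _
⊢-≔ k C (ax2 A B D) = ax2 _ _ _
⊢-≔ k C (ax3 A B)   = ax3 _ _
⊢-≔ k C (axK A B)   = axK _ _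
⊢-≔ {v} {n} k C (ax4n A) =
  subst (⊢[ v , n ]_) (sym (cong₂ _⇒_ (iter◇-≔ (suc n) A) (iter◇-≔ n A))) (ax4n _)
⊢-≔ {v} {n} k C (axBn A) = subst (⊢[ v , n ]_) (sym (symAxiom-≔ v n A)) (axBn _)
⊢-≔ k C (mp d e) = mp (⊢-≔ k C d) (⊢-≔ k C e)
⊢-≔ k C (nec d)  = nec (⊢-≔ k C d)

module _ {v : Variant} {n : ℕ} where

  infix 4 _⊩_

  data _⊩_ (Γ : List Form) : Form → Set where
    hyp : ∀ {A} → A ∈ Γ → Γ ⊩ A
    thm : ∀ {A} → ⊢[ v , n ] A → Γ ⊩ A
    app : ∀ {A B} → Γ ⊩ A ⇒ B → Γ ⊩ A → Γ ⊩ B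

  ⊢-refl : ∀ A → ⊢[ v , n ] (A ⇒ A)
  ⊢-refl A = mp (mp (ax2 A (A ⇒ A) A) (ax1 A (A ⇒ A))) (ax1 A A)

  deduction : ∀ {Γ A B} → A ∷ Γ ⊩ B → Γ ⊩ A ⇒ B
  deduction {A = A} (hyp (here refl)) = thm (⊢-refl A)
  deduction         (hyp (there x))   = app (thm (ax1 _ _)) (hyp x)
  deduction         (thm t)           = app (thm (ax1 _ _)) (thm t)
  deduction         (app f a)         = app (app (thm (ax2 _ _ _)) (deduction f)) (deduction a)

  close : ∀ {A} → [] ⊩ A → ⊢[ v , n ] A
  close (hyp ())
  close (thm t)   = t
  close (app f a) = mp (close f) (close a)

  weaken : ∀ {Γ A B} → Γ ⊩ A → B ∷ Γ ⊩ A
  weaken (hyp x)   = hyp (there x)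
  weaken (thm t)   = thm t
  weaken (app f a) = app (weaken f) (weaken a)

  h₀ : ∀ {Γ A} → A ∷ Γ ⊩ A
  h₀ = hyp (here refl)

  h₁ : ∀ {Γ A B} → B ∷ A ∷ Γ ⊩ A
  h₁ = hyp (there (here refl))

  ⊢⊤ : ⊢[ v , n ] ⊤f
  ⊢⊤ = ⊢-refl ⊥f

  ⊢-explosion : ∀ A → ⊢[ v , n ] (⊥f ⇒ A)
  ⊢-explosion A = mp (ax3 A ⊥f) (mp (ax1 ⊤f (¬f A)) ⊢⊤)

  explosion : ∀ {Γ A} → Γ ⊩ ⊥f → Γ ⊩ A
  explosion = app (thm (⊢-explosion _))

  ¬¬-elim : ∀ {Γ A} → Γ ⊩ ¬f ¬f A → Γ ⊩ A
  ¬¬-elim {A = A} d =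
    app (app (thm (ax3 A ⊤f)) (deduction (explosion (app (weaken d) h₀)))) (thm ⊢⊤)

  ⊢-trans : ∀ {A B C} → ⊢[ v , n ] (A ⇒ B) → ⊢[ v , n ] (B ⇒ C) → ⊢[ v , n ] (A ⇒ C)
  ⊢-trans ab bc = close (deduction (app (thm bc) (app (thm ab) h₀)))

  ≈-trans : ∀ {A B C} → A ≈[ v , n ] B → B ≈[ v , n ] C → A ≈[ v , n ] C
  ≈-trans (ab , ba) (bc , cb) = ⊢-trans ab bc , ⊢-trans cb ba

  ⊢⇒≈⊤ : ∀ {A} → ⊢[ v , n ] A → A ≈[ v , n ] ⊤f
  ⊢⇒≈⊤ ⊢A = mp (ax1 ⊤f _) ⊢⊤ , mp (ax1 _ ⊤f) ⊢A

  ∨-inj₁ : ∀ A B → ⊢[ v , n ] (A ⇒ A ∨f B)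
  ∨-inj₁ A B = close (deduction (deduction (explosion (app h₀ h₁))))

  ∨-absorbˡ : ∀ {A B} → ⊢[ v , n ] (A ⇒ B) → (A ∨f B) ≈[ v , n ] B
  ∨-absorbˡ ab = close (deduction (¬¬-elim (deduction
                   (app h₀ (app h₁ (deduction (app h₁ (app (thm ab) h₀))))))))
               , ax1 _ _

  ∧-elimˡ : ∀ A B → ⊢[ v , n ] (A ∧f B ⇒ A)
  ∧-elimˡ A B = close (deduction (¬¬-elim (deduction
                  (app h₁ (deduction (explosion (app h₁ h₀)))))))

  ∧⊤-intro : ∀ A → ⊢[ v , n ] (A ⇒ A ∧f ⊤f)
  ∧⊤-intro A = close (deduction (deduction (app (app h₀ h₁) (thm ⊢⊤))))

  ∧⊥-refute : ∀ A → ⊢[ v , n ] ¬f (A ∧f ⊥f)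
  ∧⊥-refute A = close (deduction (app h₀ (thm (mp (ax1 ⊤f A) ⊢⊤))))

  ¬◇-intro : ∀ {A} → ⊢[ v , n ] ¬f A → ⊢[ v , n ] ¬f (◇ A)
  ¬◇-intro ⊢¬A = close (deduction (app h₀ (thm (nec ⊢¬A))))

  ∧-fresh-≉⊥ : ∀ {A k} → varBound A ≤ k →
               ¬ (A ≈[ v , n ] ⊥f) → ¬ ((A ∧f var k) ≈[ v , n ] ⊥f)
  ∧-fresh-≉⊥ {A} {k} fresh A≉⊥ (A∧p⇒⊥ , _) = A≉⊥ (⊢-trans (∧⊤-intro A) A∧⊤⇒⊥ , ⊢-explosion A)
    where
    A∧⊤⇒⊥ : ⊢[ v , n ] (A ∧f ⊤f ⇒ ⊥f)
    A∧⊤⇒⊥ = subst (⊢[ v , n ]_)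
      (cong (λ B → B ∧f ⊤f ⇒ ⊥f) (fresh-≔ ⊤f A fresh))
      (subst (λ P → ⊢[ v , n ] ((A [ k ≔ ⊤f ]) ∧f P ⇒ ⊥f)) (var-≔ k ⊤f) (⊢-≔ k ⊤f A∧p⇒⊥))

  module _ {g : Form → Form} (M : IsModalOp v n g) where
    open IsModalOp M

    modalOp-mono : ∀ {A B} → ⊢[ v , n ] (A ⇒ B) → ⊢[ v , n ] (g A ⇒ g B)
    modalOp-mono {A} {B} ab =
      ⊢-trans (∨-inj₁ (g A) (g B))
        (⊢-trans (proj₂ (g-+ A B)) (proj₁ (cong-g (A ∨f B) B (∨-absorbˡ ab))))

    companion-≉⊥⇒⊤ : IsCompanion v n g → ∀ {A} → ¬ (A ≈[ v , n ] ⊥f) → ⊢[ v , n ] g A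
    companion-≉⊥⇒⊤ companion {A} A≉⊥ = mp ¬◇⊥⇒gA (¬◇-intro (∧⊥-refute A))
      where
      k : ℕ
      k = varBound A ⊔ varBound (g A)

      A-fresh : varBound A ≤ k
      A-fresh = m≤m⊔n (varBound A) (varBound (g A))

      ¬◇[A∧p]⇒gA : ⊢[ v , n ] (¬f (◇ (A ∧f var k)) ⇒ g A)
      ¬◇[A∧p]⇒gA = ⊢-trans (mp (proj₂ (companion _ (∧-fresh-≉⊥ A-fresh A≉⊥))) ⊢⊤)
                           (modalOp-mono (∧-elimˡ A (var k)))

      ¬◇⊥⇒gA : ⊢[ v , n ] (¬f (◇ (A ∧f ⊥f)) ⇒ g A)
      ¬◇⊥⇒gA = subst (⊢[ v , n ]_)
        (cong₂ (λ B C → ¬f (◇ (B ∧f ⊥f)) ⇒ C)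
               (fresh-≔ ⊥f A A-fresh) (fresh-≔ ⊥f (g A) (m≤n⊔m (varBound A) (varBound (g A)))))
        (subst (λ P → ⊢[ v , n ] (¬f (◇ ((A [ k ≔ ⊥f ]) ∧f P)) ⇒ (g A [ k ≔ ⊥f ])))
               (var-≔ k ⊥f) (⊢-≔ k ⊥f ¬◇[A∧p]⇒gA))

    companion⇒discriminator : IsCompanion v n g → IsDiscriminator v n g
    companion⇒discriminator companion A =
        (λ A≈⊥ → ≈-trans (cong-g A ⊥f A≈⊥) g-0)
      , (λ A≉⊥ → ⊢⇒≈⊤ (companion-≉⊥⇒⊤ companion A≉⊥))

mainTheorem20 : (v : Variant) (n : ℕ) → n ≥ 1 → ¬ HasProperCompanion v n
mainTheorem20 v n _ (g , M , companion , ¬discriminator) =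
  ¬discriminator (companion⇒discriminator M companion)
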